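{- Let $k$ be a positive integer and let $\mathfrak a$ be a primitive list of length $n$ that is at most $k$-separated (that is, $\mathfrak a$ is not $m$-separated for any integer $m>k$). Then every element of $\mathfrak a$ divides $$\prod_{p\le k} p^{r_p(n-1)},$$ where the product is over primes $p\le k$ and $p^{r_p}$ is the largest power of $p$ that is at most $k$.
   Context: A list is a finite list of non-zero integers (up to permutation); it is degenerate if it contains both $a$ and $-a$ for some $a$, and primitive if it is non-degenerate with gcd of its elements equal to $1$. For $k\ne0$, $k\mathfrak a$ denotes the list with every element multiplied by $k$. Definition: for an integer $k\ge 2$, a primitive list $\mathfrak a$ of length $n$ is $k$-separated if there are primitive lists $\mathfrak b,\mathfrak c$ with $1\le \ell(\mathfrak b)\le\ell(\mathfrak c)<n$, $\ell(\mathfrak b)+\ell(\mathfrak c)=n$, such that: (1) there are non-zero coprime integers $B,C$ with $\mathfrak a$ equal to the concatenation of $B\mathfrak b$ and $C\mathfrak c$; (2) exactly one of $B,C$ is a multiple of $k$; (3) if $k\mid B$, then for every element $kb$ of $B\mathfrak b$ and every element $c$ of $C\mathfrak c$, $\gcd(kb,c)=\gcd(b,c)$; if $k\mid C$, then for every element $kc$ of $C\mathfrak c$ and every element $b$ of $B\mathfrak b$, $\gcd(b,kc)=\gcd(b,c)$. -}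

module Defs where

open import Data.Nat as ℕ using (ℕ; _≤_; _<_; _^_; _∸_)
open import Data.Integer as ℤ using (ℤ; +_; -_; _*_; 0ℤ; 1ℤ)
open import Data.Integer.GCD using (gcd)
open import Data.Integer.Divisibility using (_∣_)
open import Data.List using (List; length; map; _++_; foldr; filter; upTo)
open import Data.Nat.ListAction using (product)
open import Data.List.Membership.Propositional using (_∈_)
open import Data.List.Relation.Unary.All using (All)
open import Data.List.Relation.Binary.Permutation.Propositional using (_↭_)
open import Data.Nat.Primality using (Prime; prime?)
open import Data.Product using (Σ; ∃; _×_; _,_)
open import Data.Sum using (_⊎_)
open import Relation.Nullary using (¬_)
open import Relation.Binary.PropositionalEquality using (_≡_; _≢_)

-- A "list" is a finite list of integers; "up to permutation" is handled by
-- comparing lists with _↭_ where equality of lists is asserted.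

gcdList : List ℤ → ℤ
gcdList = foldr gcd 0ℤ

NonZeroList : List ℤ → Set
NonZeroList xs = All (λ x → x ≢ 0ℤ) xs

Degenerate : List ℤ → Set
Degenerate xs = Σ ℤ λ a → (a ∈ xs) × ((- a) ∈ xs)

Primitive : List ℤ → Set
Primitive xs = NonZeroList xs × (¬ Degenerate xs) × (gcdList xs ≡ 1ℤ)

scale : ℤ → List ℤ → List ℤ
scale k xs = map (k *_) xs

GcdCond : ℕ → List ℤ → List ℤ → Set
GcdCond k Bb Cc =
  ∀ x y → x ∈ Bb → y ∈ Cc → ∀ b → x ≡ (+ k) * b → gcd x y ≡ gcd b y

Separated : ℕ → List ℤ → Set
Separated k a =
  (2 ≤ k) × Primitive a ×
  Σ (List ℤ) λ b → Σ (List ℤ) λ c →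
    Primitive b × Primitive c ×
    (1 ≤ length b) × (length b ≤ length c) × (length c < length a) ×
    (length b ℕ.+ length c ≡ length a) ×
    Σ ℤ λ B → Σ ℤ λ C →
      (B ≢ 0ℤ) × (C ≢ 0ℤ) × (gcd B C ≡ 1ℤ) ×
      (a ↭ (scale B b ++ scale C c)) ×
      (  ((+ k) ∣ B × ¬ ((+ k) ∣ C) × GcdCond k (scale B b) (scale C c))
       ⊎ ((+ k) ∣ C × ¬ ((+ k) ∣ B) × GcdCond k (scale C c) (scale B b)))

AtMostSeparated : ℕ → List ℤ → Set
AtMostSeparated k a = ∀ m → k < m → ¬ Separated m a

primeProduct : ℕ → (ℕ → ℕ) → ℕ → ℕ
primeProduct k r e = product (map (λ p → p ^ (r p ℕ.* e)) (filter prime? (upTo (ℕ.suc k))))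

IsMaxExp : ℕ → (ℕ → ℕ) → Set
IsMaxExp k r = ∀ p → Prime p → p ≤ k → (p ^ r p ≤ k) × (k < p ^ ℕ.suc (r p))

{-# OPTIONS --safe #-}
module Submission where

-- Let p be a prime such that p ^ (1 + R (n - 1)) divides some x ∈ a. Since gcd a = 1, some element
-- of a is prime to p, so one of the n - 1 inclusions between the sets of elements of a divisible
-- by p, p ^ (1 + R), …, p ^ (1 + (n - 1) R) is an equality: for some s = j R, every element divisible
-- by p ^ (1 + s) is divisible by p ^ (1 + s + R). Dividing the elements divisible by p ^ (1 + s),
-- and the remaining ones, by their gcds shows that a is p ^ (1 + R)-separated; the gcd condition
-- holds because p ^ s divides every cofactor on the first side while p ^ (1 + s) divides no element
-- on the other. So p ^ (1 + R) ≤ k: taking R = r_p for p ≤ k, and R = 0 for p > k, bounds the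
-- p-adic valuation of x by r_p (n - 1).

open import Defs

-- Divisibility and gcds of natural numbers
module _ where
  open import Data.Nat.Base using (ℕ; zero; suc; _+_; _*_; _^_; _∸_; _≤_; _<_; NonZero)
  open import Data.Nat.Properties
  open import Data.Nat.Divisibility
  open import Data.Nat.GCD using (gcd; gcd[m,n]∣m; gcd[m,n]∣n; gcd-greatest; c*gcd[m,n]≡gcd[cm,cn])
  open import Data.Nat.Coprimality using (Coprime; coprime-divisor)
  open import Data.Nat.Primality using (Prime; prime⇒irreducible; prime⇒nonZero; prime⇒nonTrivial)
  open import Data.Nat.Primality.Factorisation using (factorise)
  open import Data.Nat.Induction using (<-wellFounded)
  open import Data.Nat.ListAction using (product)
  open import Data.List.Base using ([]; _∷_; map)
  open import Data.List.Membership.Propositional using (_∈_)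
  open import Data.List.Relation.Unary.Any using (here; there)
  open import Data.List.Relation.Unary.All using (All; []; _∷_)
  open import Algebra.Properties.CommutativeSemigroup *-commutativeSemigroup using (x∙yz≈y∙xz)
  open import Data.Empty using (⊥-elim)
  open import Data.Product using (∃₂; _×_; _,_; proj₁; proj₂)
  open import Data.Sum using (inj₁; inj₂)
  open import Function.Base using (_∘_; case_of_; it)
  open import Induction.WellFounded using (Acc; acc)
  open import Relation.Nullary using (¬_; yes; no)
  open import Relation.Binary.PropositionalEquality

  ^-monoʳ-∣ : ∀ p {i j} → i ≤ j → p ^ i ∣ p ^ j
  ^-monoʳ-∣ p {i} {j} i≤j = divides (p ^ (j ∸ i)) (begin
    p ^ j               ≡⟨ cong (p ^_) (sym (m∸n+n≡m i≤j)) ⟩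
    p ^ (j ∸ i + i)     ≡⟨ ^-distribˡ-+-* p (j ∸ i) i ⟩
    p ^ (j ∸ i) * p ^ i ∎)
    where open ≡-Reasoning

  prime∤⇒coprime : ∀ {p n} → Prime p → ¬ p ∣ n → Coprime p n
  prime∤⇒coprime p-prime p∤n (d∣p , d∣n) with prime⇒irreducible p-prime d∣p
  ... | inj₁ d≡1 = d≡1
  ... | inj₂ refl = ⊥-elim (p∤n d∣n)

  gcd[c*m,n]≡gcd[m,n] : ∀ {c n} → Coprime c n → ∀ m → gcd (c * m) n ≡ gcd m n
  gcd[c*m,n]≡gcd[m,n] {c} {n} c⊥n m = ∣-antisym
    (gcd-greatest (coprime-divisor g⊥c (gcd[m,n]∣m (c * m) n)) (gcd[m,n]∣n (c * m) n))
    (gcd-greatest (∣-trans (gcd[m,n]∣m m n) (n∣m*n c)) (gcd[m,n]∣n m n))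
    where
    g⊥c : Coprime (gcd (c * m) n) c
    g⊥c (d∣g , d∣c) = c⊥n (d∣c , ∣-trans d∣g (gcd[m,n]∣n (c * m) n))

  gcd[c^j*m,n]≡gcd[m,n] : ∀ {c n} → Coprime c n → ∀ j m → gcd (c ^ j * m) n ≡ gcd m n
  gcd[c^j*m,n]≡gcd[m,n] {n = n} _   zero    m = cong (λ u → gcd u n) (*-identityˡ m)
  gcd[c^j*m,n]≡gcd[m,n] {c} {n} c⊥n (suc j) m = begin
    gcd (c * c ^ j * m) n   ≡⟨ cong (λ u → gcd u n) (*-assoc c (c ^ j) m) ⟩
    gcd (c * (c ^ j * m)) n ≡⟨ gcd[c*m,n]≡gcd[m,n] c⊥n (c ^ j * m) ⟩
    gcd (c ^ j * m) n       ≡⟨ gcd[c^j*m,n]≡gcd[m,n] c⊥n j m ⟩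
    gcd m n                 ∎
    where open ≡-Reasoning

  -- Cancel the common factor p from m and n until p no longer divides n.
  gcd[p^j*m,n]≡gcd[m,n] : ∀ {p} → Prime p → ∀ s j {m n} → p ^ s ∣ m → ¬ p ^ suc s ∣ n →
                          gcd (p ^ j * m) n ≡ gcd m n
  gcd[p^j*m,n]≡gcd[m,n] p-prime zero j {m} {n} _ p^1∤n =
    gcd[c^j*m,n]≡gcd[m,n] (prime∤⇒coprime p-prime (p^1∤n ∘ subst (_∣ n) (sym (*-identityʳ _)))) j m
  gcd[p^j*m,n]≡gcd[m,n] {p} p-prime (suc s) j {m} {n} p^[1+s]∣m p^[2+s]∤n with p ∣? n
  ... | no p∤n = gcd[c^j*m,n]≡gcd[m,n] (prime∤⇒coprime p-prime p∤n) j m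
  ... | yes p∣n = begin
    gcd (p ^ j * m) n                ≡⟨ cong₂ gcd (cong (p ^ j *_) m≡p*m′) n≡p*n′ ⟩
    gcd (p ^ j * (p * m′)) (p * n′)  ≡⟨ cong₂ gcd (x∙yz≈y∙xz (p ^ j) p m′) refl ⟩
    gcd (p * (p ^ j * m′)) (p * n′)  ≡⟨ c*gcd[m,n]≡gcd[cm,cn] p (p ^ j * m′) n′ ⟨
    p * gcd (p ^ j * m′) n′          ≡⟨ cong (p *_) (gcd[p^j*m,n]≡gcd[m,n] p-prime s j p^s∣m′ p^[1+s]∤n′) ⟩
    p * gcd m′ n′                    ≡⟨ c*gcd[m,n]≡gcd[cm,cn] p m′ n′ ⟩
    gcd (p * m′) (p * n′)            ≡⟨ cong₂ gcd m≡p*m′ n≡p*n′ ⟨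
    gcd m n                          ∎
    where
    open ≡-Reasoning
    instance _ = prime⇒nonZero p-prime
    p∣m = m*n∣⇒m∣ p (p ^ s) p^[1+s]∣m
    m′ = quotient p∣m
    n′ = quotient p∣n
    m≡p*m′ = m∣n⇒n≡m*quotient p∣m
    n≡p*n′ = m∣n⇒n≡m*quotient p∣n
    p^s∣m′ : p ^ s ∣ m′
    p^s∣m′ = *-cancelˡ-∣ p (subst (p * p ^ s ∣_) m≡p*m′ p^[1+s]∣m)
    p^[1+s]∤n′ : ¬ p ^ suc s ∣ n′
    p^[1+s]∤n′ p^[1+s]∣n′ = p^[2+s]∤n (subst (p * p ^ suc s ∣_) (sym n≡p*n′) (*-monoʳ-∣ p p^[1+s]∣n′))

  prime-power-split : ∀ {p} → Prime p → ∀ n → .{{NonZero n}} → ∃₂ λ a n′ → n ≡ p ^ a * n′ × ¬ p ∣ n′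
  prime-power-split {p} p-prime n = split n (<-wellFounded n)
    where
    instance _ = prime⇒nonTrivial p-prime
    split : ∀ n → Acc _<_ n → .{{NonZero n}} → ∃₂ λ a n′ → n ≡ p ^ a * n′ × ¬ p ∣ n′
    split n (acc rec) with p ∣? n
    ... | no p∤n = 0 , n , sym (*-identityˡ n) , p∤n
    ... | yes p∣n with split (quotient p∣n) (rec (quotient-< p∣n)) {{quotient≢0 p∣n}}
    ...   | a , n′ , n/p≡p^a*n′ , p∤n′ = suc a , n′ , n≡p^[1+a]*n′ , p∤n′
      where
      open ≡-Reasoning
      n≡p^[1+a]*n′ : n ≡ p * p ^ a * n′
      n≡p^[1+a]*n′ = begin
        n                ≡⟨ m∣n⇒n≡m*quotient p∣n ⟩
        p * quotient p∣n ≡⟨ cong (p *_) n/p≡p^a*n′ ⟩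
        p * (p ^ a * n′) ≡⟨ *-assoc p (p ^ a) n′ ⟨
        p * p ^ a * n′   ∎

  no-prime-divisor⇒≡1 : ∀ {n} → .{{NonZero n}} → (∀ {q} → Prime q → ¬ q ∣ n) → n ≡ 1
  no-prime-divisor⇒≡1 {n} no-divisor with factorise n
  ... | record { factors = [] ; isFactorisation = n≡1 } = n≡1
  ... | record { factors = q ∷ qs ; isFactorisation = n≡q*∏qs ; factorsPrime = q-prime ∷ _ } =
    ⊥-elim (no-divisor q-prime (divides (product qs) (trans n≡q*∏qs (*-comm q (product qs)))))

  ∣product-prime-powers : ∀ (f : ℕ → ℕ) {ps} → All Prime ps → ∀ n → .{{NonZero n}} →
    (∀ {q} → Prime q → q ∣ n → q ∈ ps × ¬ q ^ suc (f q) ∣ n) →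
    n ∣ product (map (λ p → p ^ f p) ps)
  ∣product-prime-powers f [] n bounded =
    ∣-reflexive (no-prime-divisor⇒≡1 (λ q-prime q∣n → case proj₁ (bounded q-prime q∣n) of λ ()))
  ∣product-prime-powers f {p ∷ ps} (p-prime ∷ ps-prime) n bounded
    with prime-power-split p-prime n
  ... | a , n′ , n≡p^a*n′ , p∤n′ =
    subst (_∣ _) (sym n≡p^a*n′)
      (*-pres-∣ (^-monoʳ-∣ p a≤fp) (∣product-prime-powers f ps-prime n′ {{n′≢0}} bounded′))
    where
    instance _ = prime⇒nonZero p-prime
    n′∣n : ∀ {d} → d ∣ n′ → d ∣ n
    n′∣n d∣n′ = subst (_ ∣_) (sym n≡p^a*n′) (∣n⇒∣m*n (p ^ a) d∣n′)
    n′≢0 : NonZero n′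
    n′≢0 = m*n≢0⇒n≢0 (p ^ a) {{subst NonZero n≡p^a*n′ it}}
    a≤fp : a ≤ f p
    a≤fp with a ≤? f p
    ... | yes a≤fp = a≤fp
    ... | no a≰fp = ⊥-elim (proj₂ (bounded p-prime (m*n∣⇒m∣ p (p ^ f p) p^[1+fp]∣n)) p^[1+fp]∣n)
      where p^[1+fp]∣n = subst (_ ∣_) (sym n≡p^a*n′) (∣m⇒∣m*n n′ (^-monoʳ-∣ p (≰⇒> a≰fp)))
    bounded′ : ∀ {q} → Prime q → q ∣ n′ → q ∈ ps × ¬ q ^ suc (f q) ∣ n′
    bounded′ q-prime q∣n′ with bounded q-prime (n′∣n q∣n′)
    ... | here refl , _ = ⊥-elim (p∤n′ q∣n′)
    ... | there q∈ps , q^[1+fq]∤n = q∈ps , q^[1+fq]∤n ∘ n′∣n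

-- Filters of lists
module _ where
  open import Data.Nat.Base using (ℕ; zero; suc; _+_; _∸_; _≤_; _<_; z≤n; s≤s; s≤s⁻¹)
  open import Data.Nat.Properties
  open import Data.List.Base using (List; []; _∷_; length; filter; _++_)
  open import Data.List.Properties using (filter-notAll; filter-some; partition-defn)
  open import Data.List.Membership.Propositional using (_∈_; lose)
  open import Data.List.Relation.Unary.Any using (here; there)
  open import Data.List.Relation.Binary.Permutation.Propositional using (_↭_; ↭ₛ⇒↭)
  import Data.List.Relation.Binary.Permutation.Setoid.Properties as ↭ₛ
  open import Data.Product using (∃; _×_; _,_; proj₁; proj₂)
  open import Data.Empty using (⊥-elim)
  open import Function.Base using (_∘_)
  open import Level using (Level)
  open import Relation.Nullary using (¬_; yes; no)
  open import Relation.Unary using (Pred; Decidable; _⊆_)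
  open import Relation.Unary.Properties using (∁?)
  open import Relation.Binary.PropositionalEquality

  private variable
    a ℓ : Level
    A : Set a

  ↭-filter-partition : {P : Pred A ℓ} (P? : Decidable P) (xs : List A) →
                       xs ↭ filter P? xs ++ filter (∁? P?) xs
  ↭-filter-partition P? xs =
    subst (λ parts → xs ↭ proj₁ parts ++ proj₂ parts) (partition-defn P? xs)
          (↭ₛ⇒↭ (↭ₛ.partition-↭ (setoid _) P? xs))

  module _ {P Q : Pred A ℓ} (P? : Decidable P) (Q? : Decidable Q) (Q⊆P : Q ⊆ P) where

    length-filter-mono : ∀ xs → length (filter Q? xs) ≤ length (filter P? xs)
    length-filter-mono [] = z≤n
    length-filter-mono (x ∷ xs) with Q? x | P? x
    ... | yes _  | yes _  = s≤s (length-filter-mono xs)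
    ... | yes qx | no ¬px = ⊥-elim (¬px (Q⊆P qx))
    ... | no _   | yes _  = m≤n⇒m≤1+n (length-filter-mono xs)
    ... | no _   | no _   = length-filter-mono xs

    length-filter-< : ∀ {xs y} → y ∈ xs → P y → ¬ Q y → length (filter Q? xs) < length (filter P? xs)
    length-filter-< {x ∷ xs} (here refl) px ¬qx with Q? x | P? x
    ... | yes qx | _      = ⊥-elim (¬qx qx)
    ... | no _   | yes _  = s≤s (length-filter-mono xs)
    ... | no _   | no ¬px = ⊥-elim (¬px px)
    length-filter-< {x ∷ xs} (there y∈xs) py ¬qy with Q? x | P? x
    ... | yes _  | yes _  = s≤s (length-filter-< y∈xs py ¬qy)
    ... | yes qx | no ¬px = ⊥-elim (¬px (Q⊆P qx))
    ... | no _   | yes _  = m≤n⇒m≤1+n (length-filter-< y∈xs py ¬qy)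
    ... | no _   | no _   = length-filter-< y∈xs py ¬qy

    length-filter-≤⇒⊇ : ∀ {xs} → length (filter P? xs) ≤ length (filter Q? xs) →
                        ∀ {y} → y ∈ xs → P y → Q y
    length-filter-≤⇒⊇ ∣P∣≤∣Q∣ {y} y∈xs py with Q? y
    ... | yes qy = qy
    ... | no ¬qy = ⊥-elim (<⇒≱ (length-filter-< y∈xs py ¬qy) ∣P∣≤∣Q∣)

  -- If c dropped at each of its first e steps, c e + e would be at most c 0.
  non-decreasing-step : ∀ e (c : ℕ → ℕ) → c 0 < c e + e → ∃ λ j → j < e × c j ≤ c (suc j)
  non-decreasing-step zero    c c0<c0+0 = ⊥-elim (<-irrefl (sym (+-identityʳ (c 0))) c0<c0+0)
  non-decreasing-step (suc e) c c0<ce+e with c 0 ≤? c 1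
  ... | yes c0≤c1 = 0 , s≤s z≤n , c0≤c1
  ... | no c0≰c1
    with non-decreasing-step e (c ∘ suc)
           (<-≤-trans (≰⇒> c0≰c1) (s≤s⁻¹ (subst (c 0 <_) (+-suc (c (suc e)) e) c0<ce+e)))
  ... | j , j<e , cj≤cj+1 = suc j , s≤s j<e , cj≤cj+1

  module _ {D : ℕ → Pred A ℓ} (D? : ∀ j → Decidable (D j))
           (D-antitone : ∀ {i j} → i ≤ j → D j ⊆ D i) where

    filter-chain-stabilises : ∀ {xs y x} → y ∈ xs → ¬ D 0 y → x ∈ xs → D (length xs ∸ 1) x →
      ∃ λ j → j < length xs ∸ 1 × (∀ {z} → z ∈ xs → D j z → D (suc j) z)
    filter-chain-stabilises {xs} y∈xs ¬D₀y x∈xs Dₑx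
      with non-decreasing-step e count count₀<countₑ+e
      where
      e = length xs ∸ 1
      count : ℕ → ℕ
      count j = length (filter (D? j) xs)
      count₀≤e : count 0 ≤ e
      count₀≤e = subst (count 0 ≤_) (pred[m∸n]≡m∸[1+n] (length xs) 0)
                   (suc[m]≤n⇒m≤pred[n] (filter-notAll (D? 0) xs (lose y∈xs ¬D₀y)))
      count₀<countₑ+e : count 0 < count e + e
      count₀<countₑ+e = +-mono-≤ (filter-some (D? e) (lose x∈xs Dₑx)) count₀≤e
    ... | j , j<e , countⱼ≤countⱼ₊₁ =
      j , j<e , length-filter-≤⇒⊇ (D? j) (D? (suc j)) (D-antitone (n≤1+n j)) countⱼ≤countⱼ₊₁

-- Gcds of lists of integers and separated lists
module _ where
  open import Data.Nat.Base as ℕ using (ℕ; _≤_; _<_; z≤n; s≤s)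
  import Data.Nat.Properties as ℕ
  import Data.Nat.Divisibility as ℕ
  open import Data.Integer.Base using (ℤ; +_; -_; _*_; ∣_∣; 0ℤ; 1ℤ; ≢-nonZero)
  open import Data.Integer.Properties using (∣i∣≡0⇒i≡0; *-comm; *-identityʳ; *-zeroʳ; neg-distribʳ-*)
  open import Data.Integer.Divisibility using (_∣_; *-monoʳ-∣; *-cancelˡ-∣)
  open import Data.Integer.Divisibility.Signed using (divides; ∣ᵤ⇒∣)
  open import Data.Integer.GCD using (gcd; gcd[i,j]∣i; gcd[i,j]∣j; gcd-greatest; gcd-comm)
  open import Data.List.Base using ([]; _∷_; length; _++_; filter)
  open import Data.List.Properties using (length-map; length-++)
  open import Data.List.Membership.Propositional using (_∈_; find)
  open import Data.List.Membership.Propositional.Properties using (∈-map⁺; ∈-map⁻; ∈-filter⁺; ∈-filter⁻)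
  open import Data.List.Relation.Binary.Subset.Propositional using (_⊆_)
  open import Data.List.Relation.Unary.Any using (here; there)
  import Data.List.Relation.Unary.All as All
  open import Data.List.Relation.Unary.All.Properties using (¬All⇒Any¬)
  open import Data.List.Relation.Binary.Permutation.Propositional using (_↭_; ↭-trans)
  open import Data.List.Relation.Binary.Permutation.Propositional.Properties using (↭-length; ++-comm)
  open import Data.Product using (∃; _×_; _,_; proj₁; proj₂)
  open import Data.Sum using (inj₁; inj₂)
  open import Data.Empty using (⊥-elim)
  open import Relation.Nullary using (¬_; yes; no)
  open import Relation.Unary using (Pred; Decidable)
  open import Relation.Unary.Properties using (∁?)
  open import Relation.Binary.PropositionalEquality
  open import Function.Base using (_∘_)

  gcdList-∣ : ∀ {xs y} → y ∈ xs → gcdList xs ∣ y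
  gcdList-∣ {x ∷ xs} (here refl)  = gcd[i,j]∣i x (gcdList xs)
  gcdList-∣ {x ∷ xs} (there y∈xs) = ℕ.∣-trans (gcd[i,j]∣j x (gcdList xs)) (gcdList-∣ y∈xs)

  ∣-gcdList : ∀ {d} xs → (∀ {y} → y ∈ xs → d ∣ y) → d ∣ gcdList xs
  ∣-gcdList []       _         = ℕ._∣0 _
  ∣-gcdList {d} (x ∷ xs) d∣members =
    gcd-greatest {x} {gcdList xs} {d} (d∣members (here refl)) (∣-gcdList {d} xs (d∣members ∘ there))

  gcdList≡+∣gcdList∣ : ∀ xs → gcdList xs ≡ + ∣ gcdList xs ∣
  gcdList≡+∣gcdList∣ []      = refl
  gcdList≡+∣gcdList∣ (_ ∷ _) = refl

  gcdList≢0 : ∀ {xs y} → y ∈ xs → y ≢ 0ℤ → gcdList xs ≢ 0ℤ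
  gcdList≢0 {y = y} y∈xs y≢0 g≡0 =
    y≢0 (∣i∣≡0⇒i≡0 (ℕ.0∣⇒≡0 (subst (_∣ y) g≡0 (gcdList-∣ y∈xs))))

  divide-list : ∀ {g} xs → (∀ {y} → y ∈ xs → g ∣ y) → ∃ λ bs → scale g bs ≡ xs
  divide-list []       _         = [] , refl
  divide-list {g} (x ∷ xs) g∣members
    with ∣ᵤ⇒∣ {g} {x} (g∣members (here refl)) | divide-list {g} xs (g∣members ∘ there)
  ... | divides q x≡q*g | bs , g*bs≡xs = q ∷ bs , cong₂ _∷_ (trans (*-comm g q) (sym x≡q*g)) g*bs≡xs

  primitive-part : ∀ {a Q y} → Primitive a → Q ⊆ a → y ∈ Q →
                   ∃ λ bs → Primitive bs × scale (gcdList Q) bs ≡ Q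
  primitive-part {a} {Q} (a-nonzero , a-nondeg , _) Q⊆a y∈Q =
    bs , (bs-nonzero , bs-nondeg , gcd[bs]≡1) , g*bs≡Q
    where
    g = gcdList Q
    g≢0 : g ≢ 0ℤ
    g≢0 = gcdList≢0 y∈Q (All.lookup a-nonzero (Q⊆a y∈Q))
    instance _ = ≢-nonZero g≢0
    split = divide-list {g} Q gcdList-∣
    bs = proj₁ split
    g*bs≡Q = proj₂ split
    g*-∈a : ∀ {b} → b ∈ bs → g * b ∈ a
    g*-∈a {b} b∈bs = Q⊆a (subst (g * b ∈_) g*bs≡Q (∈-map⁺ (g *_) b∈bs))
    bs-nonzero : NonZeroList bs
    bs-nonzero = All.tabulate λ b∈bs b≡0 →
      All.lookup a-nonzero (g*-∈a b∈bs) (trans (cong (g *_) b≡0) (*-zeroʳ g))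
    bs-nondeg : ¬ Degenerate bs
    bs-nondeg (b , b∈bs , -b∈bs) =
      a-nondeg (g * b , g*-∈a b∈bs , subst (_∈ a) (sym (neg-distribʳ-* g b)) (g*-∈a -b∈bs))
    g*gcd[bs]∣members : ∀ {z} → z ∈ Q → g * gcdList bs ∣ z
    g*gcd[bs]∣members {z} z∈Q with ∈-map⁻ (g *_) (subst (z ∈_) (sym g*bs≡Q) z∈Q)
    ... | b , b∈bs , refl = *-monoʳ-∣ g (gcdList-∣ b∈bs)
    g*gcd[bs]∣g : g * gcdList bs ∣ g * 1ℤ
    g*gcd[bs]∣g = subst (g * gcdList bs ∣_) (sym (*-identityʳ g)) (∣-gcdList {g * gcdList bs} Q g*gcd[bs]∣members)
    gcd[bs]≡1 : gcdList bs ≡ 1ℤ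
    gcd[bs]≡1 = trans (gcdList≡+∣gcdList∣ bs)
                      (cong +_ (ℕ.∣1⇒≡1 (*-cancelˡ-∣ g {gcdList bs} {1ℤ} g*gcd[bs]∣g)))

  length-↭-scale-++ : ∀ {a b c B C} → a ↭ scale B b ++ scale C c → length a ≡ length b ℕ.+ length c
  length-↭-scale-++ {a} {b} {c} {B} {C} a↭Bb++Cc = begin
    length a                                 ≡⟨ ↭-length a↭Bb++Cc ⟩
    length (scale B b ++ scale C c)          ≡⟨ length-++ (scale B b) ⟩
    length (scale B b) ℕ.+ length (scale C c) ≡⟨ cong₂ ℕ._+_ (length-map (B *_) b) (length-map (C *_) c) ⟩
    length b ℕ.+ length c                    ∎
    where open ≡-Reasoning

  separated-of-split : ∀ {m a b c B C} → 2 ≤ m → Primitive a → Primitive b → Primitive c →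
    1 ≤ length b → 1 ≤ length c → B ≢ 0ℤ → C ≢ 0ℤ → gcd B C ≡ 1ℤ → a ↭ scale B b ++ scale C c →
    + m ∣ B → ¬ + m ∣ C → GcdCond m (scale B b) (scale C c) → Separated m a
  separated-of-split {b = b} {c} {B} {C}
    2≤m prim-a prim-b prim-c 1≤∣b∣ 1≤∣c∣ B≢0 C≢0 gcd≡1 a↭Bb++Cc m∣B m∤C cond
    with ℕ.≤-total (length b) (length c)
  ... | inj₁ ∣b∣≤∣c∣ =
    2≤m , prim-a , b , c , prim-b , prim-c , 1≤∣b∣ , ∣b∣≤∣c∣ ,
    subst (length c <_) (sym ∣a∣≡∣b∣+∣c∣) (ℕ.m<n+m (length c) 1≤∣b∣) , sym ∣a∣≡∣b∣+∣c∣ ,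
    B , C , B≢0 , C≢0 , gcd≡1 , a↭Bb++Cc , inj₁ (m∣B , m∤C , cond)
    where ∣a∣≡∣b∣+∣c∣ = length-↭-scale-++ {b = b} {c} {B} {C} a↭Bb++Cc
  ... | inj₂ ∣c∣≤∣b∣ =
    2≤m , prim-a , c , b , prim-c , prim-b , 1≤∣c∣ , ∣c∣≤∣b∣ ,
    subst (length b <_) (sym ∣a∣≡∣b∣+∣c∣) (ℕ.m<m+n (length b) 1≤∣c∣) ,
    trans (ℕ.+-comm (length c) (length b)) (sym ∣a∣≡∣b∣+∣c∣) ,
    C , B , C≢0 , B≢0 , trans (gcd-comm C B) gcd≡1 , ↭-trans a↭Bb++Cc (++-comm (scale B b) (scale C c)) ,
    inj₂ (m∣B , m∤C , cond)
    where ∣a∣≡∣b∣+∣c∣ = length-↭-scale-++ {b = b} {c} {B} {C} a↭Bb++Cc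

  1≤length-scale : ∀ {g bs xs y} → scale g bs ≡ xs → y ∈ xs → 1 ≤ length bs
  1≤length-scale {bs = []}    refl ()
  1≤length-scale {bs = _ ∷ _} _    _ = s≤s z≤n

  primitive⇒∃∤ : ∀ {a} → Primitive a → ∀ {d} → d ≢ 1 → ∃ λ y → y ∈ a × ¬ + d ∣ y
  primitive⇒∃∤ {a} (_ , _ , gcd[a]≡1) {d} d≢1 with All.all? (λ y → d ℕ.∣? ∣ y ∣) a
  ... | yes d∣all =
    ⊥-elim (d≢1 (ℕ.∣1⇒≡1 (subst (+ d ∣_) gcd[a]≡1 (∣-gcdList {+ d} a (All.lookup d∣all)))))
  ... | no ¬d∣all = find (¬All⇒Any¬ (λ y → d ℕ.∣? ∣ y ∣) a ¬d∣all)

  separated-by-partition : ∀ {m a ℓ} {P : Pred ℤ ℓ} (P? : Decidable P) → 2 ≤ m → Primitive a →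
    ∀ {x y} → x ∈ a → P x → y ∈ a → ¬ + m ∣ y → (∀ {z} → z ∈ a → P z → + m ∣ z) →
    GcdCond m (filter P? a) (filter (∁? P?) a) → Separated m a
  separated-by-partition {m} {a} P? 2≤m prim-a {x} {y} x∈a Px y∈a m∤y m∣P cond =
    separated-of-split 2≤m prim-a prim-bH prim-bL
      (1≤length-scale {B} B*bH≡H x∈H) (1≤length-scale {C} C*bL≡L y∈L)
      (gcdList≢0 x∈H (nonzero x∈a)) (gcdList≢0 y∈L (nonzero y∈a)) gcd[B,C]≡1
      (subst₂ (λ H′ L′ → a ↭ H′ ++ L′) (sym B*bH≡H) (sym C*bL≡L) (↭-filter-partition P? a))
      m∣B m∤C (subst₂ (GcdCond m) (sym B*bH≡H) (sym C*bL≡L) cond)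
    where
    H = filter P? a
    L = filter (∁? P?) a
    B = gcdList H
    C = gcdList L
    nonzero : ∀ {z} → z ∈ a → z ≢ 0ℤ
    nonzero = All.lookup (proj₁ prim-a)
    x∈H = ∈-filter⁺ P? x∈a Px
    y∈L = ∈-filter⁺ (∁? P?) y∈a (m∤y ∘ m∣P y∈a)
    H⊆a : H ⊆ a
    H⊆a = proj₁ ∘ ∈-filter⁻ P?
    L⊆a : L ⊆ a
    L⊆a = proj₁ ∘ ∈-filter⁻ (∁? P?)
    H-part = primitive-part prim-a H⊆a x∈H
    bH = proj₁ H-part
    prim-bH = proj₁ (proj₂ H-part)
    B*bH≡H = proj₂ (proj₂ H-part)
    L-part = primitive-part prim-a L⊆a y∈L
    bL = proj₁ L-part
    prim-bL = proj₁ (proj₂ L-part)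
    C*bL≡L = proj₂ (proj₂ L-part)
    m∣B : + m ∣ B
    m∣B = ∣-gcdList {+ m} H λ z∈H → m∣P (H⊆a z∈H) (proj₂ (∈-filter⁻ P? {xs = a} z∈H))
    m∤C : ¬ + m ∣ C
    m∤C m∣C = m∤y (ℕ.∣-trans m∣C (gcdList-∣ y∈L))
    gcd[B,C]∣a : ∀ {z} → z ∈ a → gcd B C ∣ z
    gcd[B,C]∣a {z} z∈a with P? z
    ... | yes Pz = ℕ.∣-trans (gcd[i,j]∣i B C) (gcdList-∣ (∈-filter⁺ P? z∈a Pz))
    ... | no ¬Pz = ℕ.∣-trans (gcd[i,j]∣j B C) (gcdList-∣ (∈-filter⁺ (∁? P?) z∈a ¬Pz))
    gcd[B,C]≡1 : gcd B C ≡ 1ℤ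
    gcd[B,C]≡1 =
      cong +_ (ℕ.∣1⇒≡1 (subst (gcd B C ∣_) (proj₂ (proj₂ prim-a)) (∣-gcdList {gcd B C} a gcd[B,C]∣a)))

-- Separation along the powers of a prime
module _ where
  open import Data.Nat.Base as ℕ using (ℕ; suc; _*_; _^_; _∸_; _≤_; s≤s; nonTrivial⇒n>1; nonTrivial⇒≢1)
  open import Data.Nat.Properties
    using (*-monoˡ-≤; m≤m+n; m≤m*n; m^n≢0; ^-distribˡ-+-*; *-comm; *-identityʳ; <⇒≤; ≤-trans)
  open import Data.Nat.Divisibility as ℕ using (_∣?_; *-cancelˡ-∣)
  import Data.Nat.GCD as ℕ
  open import Data.Nat.Primality using (Prime; prime⇒nonZero; prime⇒nonTrivial)
  open import Data.Integer.Base using (ℤ; +_; ∣_∣)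
  open import Data.Integer.Properties using (abs-*)
  open import Data.Integer.Divisibility using (_∣_)
  open import Data.List.Base using (length; filter)
  open import Data.List.Membership.Propositional using (_∈_)
  open import Data.List.Membership.Propositional.Properties using (∈-filter⁻)
  open import Data.Product using (_,_; proj₁; proj₂)
  open import Relation.Nullary using (¬_)
  open import Relation.Unary using (Decidable; _⊆_)
  open import Relation.Unary.Properties using (∁?)
  open import Relation.Binary.PropositionalEquality
  open import Function.Base using (_∘_)

  module _ {p} (p-prime : Prime p) (R : ℕ) where
    private
      instance _ = prime⇒nonZero p-prime
      m = p ^ suc R

      Level : ℕ → ℤ → Set
      Level j z = + (p ^ suc (j * R)) ∣ z

      Level? : ∀ j → Decidable (Level j)
      Level? j z = p ^ suc (j * R) ∣? ∣ z ∣

      Level-antitone : ∀ {i j} → i ≤ j → Level j ⊆ Level i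
      Level-antitone i≤j = ℕ.∣-trans (^-monoʳ-∣ p (s≤s (*-monoˡ-≤ R i≤j)))

      2≤m : 2 ≤ m
      2≤m = ≤-trans (nonTrivial⇒n>1 p {{prime⇒nonTrivial p-prime}}) (m≤m*n p (p ^ R) {{m^n≢0 p R}})

      -- p ^ (jR) divides the cofactor w of every element m w on level j + 1, and nothing off level j
      -- is divisible by p ^ (1 + jR).
      gcd-condition : ∀ {a} j → (∀ {z} → z ∈ a → Level j z → Level (suc j) z) →
                      GcdCond m (filter (Level? j) a) (filter (∁? (Level? j)) a)
      gcd-condition {a} j stable u v u∈H v∈L w u≡m*w = cong +_ (begin
        ℕ.gcd (∣ u ∣) (∣ v ∣)       ≡⟨ cong (λ t → ℕ.gcd t (∣ v ∣)) ∣u∣≡m*∣w∣ ⟩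
        ℕ.gcd (m * ∣ w ∣) (∣ v ∣)   ≡⟨ gcd[p^j*m,n]≡gcd[m,n] p-prime (j * R) (suc R) p^[jR]∣w v∉Level ⟩
        ℕ.gcd (∣ w ∣) (∣ v ∣)       ∎)
        where
        open ≡-Reasoning
        ∣u∣≡m*∣w∣ = trans (cong ∣_∣ u≡m*w) (abs-* (+ m) w)
        v∉Level = proj₂ (∈-filter⁻ (∁? (Level? j)) {xs = a} v∈L)
        m*p^[jR]∣m*w : m * p ^ (j * R) ℕ.∣ m * ∣ w ∣
        u∈a×u-on-level = ∈-filter⁻ (Level? j) {xs = a} u∈H
        m*p^[jR]∣m*w = subst₂ ℕ._∣_ (^-distribˡ-+-* p (suc R) (j * R)) ∣u∣≡m*∣w∣
                         (stable (proj₁ u∈a×u-on-level) (proj₂ u∈a×u-on-level))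
        p^[jR]∣w : p ^ (j * R) ℕ.∣ ∣ w ∣
        p^[jR]∣w = *-cancelˡ-∣ m {{m^n≢0 p (suc R)}} m*p^[jR]∣m*w

    separated-of-prime-power-divisor : ∀ {a x} → Primitive a → x ∈ a →
      + (p ^ suc (R * (length a ∸ 1))) ∣ x → Separated (p ^ suc R) a
    separated-of-prime-power-divisor {a} {x} prim-a x∈a p^[1+Re]∣x =
      let y , y∈a , p∤y = primitive⇒∃∤ prim-a (nonTrivial⇒≢1 {{prime⇒nonTrivial p-prime}})
          x-on-top : Level (length a ∸ 1) x
          x-on-top = subst (λ t → + (p ^ suc t) ∣ x) (*-comm R (length a ∸ 1)) p^[1+Re]∣x
          j , j<e , stable = filter-chain-stabilises Level? Level-antitone
                               y∈a (p∤y ∘ subst (ℕ._∣ ∣ y ∣) (*-identityʳ p)) x∈a x-on-top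
      in separated-by-partition (Level? j) 2≤m prim-a
           x∈a (Level-antitone (<⇒≤ j<e) {x} x-on-top)
           y∈a (p∤y ∘ ℕ.∣-trans (ℕ.m∣m*n (p ^ R)))
           (λ z∈a → ℕ.∣-trans (^-monoʳ-∣ p (s≤s (m≤m+n R (j * R)))) ∘ stable z∈a)
           (gcd-condition j stable)

open import Data.Nat using (ℕ; _≤_; _∸_)
open import Data.Integer using (+_)
open import Data.Integer.Divisibility using (_∣_)
open import Data.List using (List; length)
open import Data.List.Membership.Propositional using (_∈_)
open import Data.Integer using (ℤ)
open import Data.Nat as ℕ using (suc; _*_; _^_; _<_; s≤s)
open import Data.Nat.Properties using (_≤?_; ≰⇒>; *-identityʳ)
open import Data.Nat.Primality using (Prime; prime?)
open import Data.Integer using (∣_∣)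
open import Data.Integer.Properties using (∣i∣≡0⇒i≡0)
open import Data.List using (filter; upTo)
open import Data.List.Membership.Propositional.Properties using (∈-filter⁺; ∈-upTo⁺)
open import Data.List.Relation.Unary.All using (lookup)
open import Data.List.Relation.Unary.All.Properties using (all-filter)
open import Data.Product using (_×_; _,_; proj₁; proj₂)
open import Data.Empty using (⊥-elim)
open import Function.Base using (_∘_)
open import Relation.Nullary using (¬_; yes; no)
open import Relation.Binary.PropositionalEquality using (_≡_; subst; sym)

proposition2p4 : (k : ℕ) → 1 ≤ k → (a : List ℤ) → Primitive a → AtMostSeparated k a →
    (r : ℕ → ℕ) → IsMaxExp k r →
    ∀ x → x ∈ a → x ∣ (+ primeProduct k r (length a ∸ 1))
proposition2p4 k _ a prim-a at-most r max-exp x x∈a =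
  ∣product-prime-powers (λ p → r p * e) (all-filter prime? (upTo (suc k))) ∣ x ∣ {{x≢0}} bounded
  where
  e = length a ∸ 1
  x≢0 = ℕ.≢-nonZero (lookup (proj₁ prim-a) x∈a ∘ ∣i∣≡0⇒i≡0)
  q¹≡q : ∀ q → q ^ 1 ≡ q
  q¹≡q = *-identityʳ
  ∤x : ∀ {q} → Prime q → ∀ R → k < q ^ suc R → ¬ + (q ^ suc (R * e)) ∣ x
  ∤x {q} q-prime R k<q^[1+R] =
    at-most (q ^ suc R) k<q^[1+R] ∘ separated-of-prime-power-divisor q-prime R prim-a x∈a
  bounded : ∀ {q} → Prime q → + q ∣ x → q ∈ filter prime? (upTo (suc k)) × ¬ + (q ^ suc (r q * e)) ∣ x
  bounded {q} q-prime q∣x with q ≤? k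
  ... | yes q≤k =
    ∈-filter⁺ prime? (∈-upTo⁺ (s≤s q≤k)) q-prime , ∤x q-prime (r q) (proj₂ (max-exp q q-prime q≤k))
  ... | no q≰k =
    ⊥-elim (∤x q-prime 0 (subst (k <_) (sym (q¹≡q q)) (≰⇒> q≰k)) (subst (λ d → + d ∣ x) (sym (q¹≡q q)) q∣x))
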